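{- Let $V=\mathbb{F}_2^n$ with $n\ge 3$. The automorphism group of the graph $\Gamma_1$ is the orthogonal group $\mathrm{O}^+(2n,2)$, acting on anti-flags via the identification $f$ described below.
   Context: An anti-flag of $\mathrm{PG}(n-1,2)$ is a pair $(p,H)$ of a point $p$ and a hyperplane $H$ with $p\notin H$. For distinct anti-flags, $(p_1,H_1)\sim_1(p_2,H_2)$ iff $p_j\in H_{3-j}$ and $p_{3-j}\notin H_j$ for some $j\in\{1,2\}$; $\Gamma_1$ is the graph on anti-flags with adjacency $\sim_1$. On $W=V\times V^*$ let $Q(x,x^*)=x^*(x)$; $\mathrm{O}^+(2n,2)$ is the group of linear automorphisms of $W$ preserving $Q$. A point $\langle w\rangle$ of $\mathrm{PG}(2n-1,2)$ is non-singular if $Q(w)=1$; the map $f:\langle(x,x^*)\rangle\mapsto(\langle x\rangle,\ker x^*)$ is a bijection from non-singular points onto anti-flags, through which $\mathrm{O}^+(2n,2)$ acts on anti-flags. -}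

module Defs where

open import Data.Nat using (ℕ; zero; suc; _≤_)
open import Data.Bool using (Bool; true; false; _∧_; _xor_)
open import Data.Vec using (Vec; []; _∷_; zipWith)
open import Data.Product using (Σ; _×_; _,_; proj₁; proj₂)
open import Data.Sum using (_⊎_)
open import Relation.Binary.PropositionalEquality using (_≡_; _≢_)
open import Relation.Nullary using (¬_)

-- V = F₂ⁿ (also used for V* via the standard dot-product pairing)
V : ℕ → Set
V n = Vec Bool n

_⊕_ : ∀ {n} → V n → V n → V n
_⊕_ = zipWith _xor_

dot : ∀ {n} → V n → V n → Bool
dot [] [] = false
dot (a ∷ as) (x ∷ xs) = (a ∧ x) xor dot as xs

-- Points of PG(n-1,2) = nonzero vectors; hyperplanes = ker x* for nonzero x* ∈ V*.
-- Point p lies in hyperplane ker H  iff  H(p) = 0.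
_∈H_ : ∀ {n} → V n → V n → Set
p ∈H H = dot H p ≡ false

-- Anti-flag (⟨p⟩, ker H) with p ∉ ker H, i.e. H(p) = 1
-- (this forces p ≠ 0 and H ≠ 0).
AntiFlag : ℕ → Set
AntiFlag n = Σ (V n × V n) (λ pH → dot (proj₂ pH) (proj₁ pH) ≡ true)

pt : ∀ {n} → AntiFlag n → V n
pt a = proj₁ (proj₁ a)

hyp : ∀ {n} → AntiFlag n → V n
hyp a = proj₂ (proj₁ a)

Adj₁ : ∀ {n} → AntiFlag n → AntiFlag n → Set
Adj₁ a b = a ≢ b ×
  ( (pt a ∈H hyp b × ¬ (pt b ∈H hyp a))
  ⊎ (pt b ∈H hyp a × ¬ (pt a ∈H hyp b)) )

IsAutΓ₁ : ∀ {n} → (AntiFlag n → AntiFlag n) → Set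
IsAutΓ₁ {n} σ =
  Σ (AntiFlag n → AntiFlag n) (λ τ →
    (∀ a → τ (σ a) ≡ a) × (∀ a → σ (τ a) ≡ a)) ×
  (∀ a b → (Adj₁ a b → Adj₁ (σ a) (σ b)) × (Adj₁ (σ a) (σ b) → Adj₁ a b))

-- W = V × V*, with quadratic form Q(x, x*) = x*(x)
W : ℕ → Set
W n = V n × V n

_⊕W_ : ∀ {n} → W n → W n → W n
(x , a) ⊕W (y , b) = (x ⊕ y , a ⊕ b)

Q : ∀ {n} → W n → Bool
Q (x , a) = dot a x

-- O⁺(2n,2): invertible F₂-linear maps of W preserving Q
-- (over F₂ linearity = additivity).
record OPlus (n : ℕ) : Set where
  field
    g      : W n → W n
    ginv   : W n → W n
    linear : ∀ u w → g (u ⊕W w) ≡ g u ⊕W g w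
    left   : ∀ w → ginv (g w) ≡ w
    right  : ∀ w → g (ginv w) ≡ w
    presQ  : ∀ w → Q (g w) ≡ Q w
open OPlus public

-- non-singular points ⟨w⟩ (over F₂ a projective point is a nonzero vector)
NonSing : ℕ → Set
NonSing n = Σ (W n) (λ w → Q w ≡ true)

-- the bijection f : ⟨(x,x*)⟩ ↦ (⟨x⟩, ker x*)
f : ∀ {n} → NonSing n → AntiFlag n
f ((x , a) , q) = ((x , a) , q)

f⁻¹ : ∀ {n} → AntiFlag n → NonSing n
f⁻¹ ((x , a) , q) = ((x , a) , q)

actNS : ∀ {n} → OPlus n → NonSing n → NonSing n
actNS {n} G (w , q) = (g G w , go)
  where
  open import Relation.Binary.PropositionalEquality using (trans)
  go : Q (g G w) ≡ true
  go = trans (presQ G w) q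

act : ∀ {n} → OPlus n → AntiFlag n → AntiFlag n
act G a = f (actNS G (f⁻¹ a))

{-# OPTIONS --safe #-}
-- Through f an anti-flag (⟨x⟩, ker x*) is the non-singular vector (x, x*) of (W, Q), and two
-- anti-flags are adjacent in Γ₁ exactly when the polar form B((x, a), (y, b)) = a(y) + b(x) of Q
-- is 1 on them.  Hence O⁺(2n,2), which preserves Q and therefore B, acts by automorphisms.
-- Conversely, for n ≥ 2 the non-singular vectors span W and B is non-degenerate, so an
-- automorphism σ extends to the linear map Σ vᵢ ↦ Σ σ(vᵢ): it is well defined because σ
-- preserves B and its image spans W, and it preserves Q because Q of a sum is determined by
-- the Q- and B-values of the summands.  The same spanning property makes the action faithful.
module Submission where

open import Defs
open import Algebra.Bundles using (CommutativeRing)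
open import Axiom.UniquenessOfIdentityProofs using (module Decidable⇒UIP)
open import Data.Bool using (Bool; true; false; _∧_; _xor_; _≟_)
open import Data.Bool.Properties
  using ( xor-assoc; xor-comm; xor-same; xor-identityˡ; xor-identityʳ; xor-∧-commutativeRing
        ; ∧-comm; ∧-distribʳ-xor; ⇔→≡)
open import Algebra.Properties.CommutativeSemigroup
  (CommutativeRing.+-commutativeSemigroup xor-∧-commutativeRing) using (interchange)
open import Data.Empty using (⊥-elim)
open import Data.List using (List; []; _∷_; _++_; map)
open import Data.List.Properties using (map-++)
open import Data.Nat using (ℕ; suc; _+_; _≤_; s≤s)
open import Data.Nat.Properties using (<⇒≤)
open import Data.Product using (Σ; _×_; _,_; proj₁; proj₂)
open import Data.Sum using (_⊎_; inj₁; inj₂)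
open import Data.Vec using ([]; _∷_; replicate)
import Data.Vec as Vec
open import Data.Vec.Properties using (zipWith-assoc; zipWith-identityˡ; zipWith-identityʳ)
open import Function using (_∘_; _⇔_; mk⇔; Equivalence)
open import Relation.Binary.PropositionalEquality
open ≡-Reasoning

xor-cancelˡ : ∀ x y → x xor (x xor y) ≡ y
xor-cancelˡ x y = trans (sym (xor-assoc x x y)) (cong (_xor y) (xor-same x))

xor≡true⇔ : ∀ x y →
  x xor y ≡ true ⇔ ((y ≡ false × x ≢ false) ⊎ (x ≡ false × y ≢ false))
xor≡true⇔ false false = mk⇔ (λ ())
  λ { (inj₁ (_ , x≢false)) → ⊥-elim (x≢false refl) ; (inj₂ (_ , y≢false)) → ⊥-elim (y≢false refl) }
xor≡true⇔ false true  = mk⇔ (λ _ → inj₂ (refl , λ ())) (λ _ → refl)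
xor≡true⇔ true  false = mk⇔ (λ _ → inj₁ (refl , λ ())) (λ _ → refl)
xor≡true⇔ true  true  = mk⇔ (λ ()) λ { (inj₁ (() , _)) ; (inj₂ (() , _)) }

0V : ∀ {n} → V n
0V = replicate _ false

⊕-assoc : ∀ {n} (x y z : V n) → (x ⊕ y) ⊕ z ≡ x ⊕ (y ⊕ z)
⊕-assoc = zipWith-assoc xor-assoc

⊕-identityˡ : ∀ {n} (x : V n) → 0V ⊕ x ≡ x
⊕-identityˡ = zipWith-identityˡ xor-identityˡ

⊕-identityʳ : ∀ {n} (x : V n) → x ⊕ 0V ≡ x
⊕-identityʳ = zipWith-identityʳ xor-identityʳ

⊕-self : ∀ {n} (x : V n) → x ⊕ x ≡ 0V
⊕-self []      = refl
⊕-self (α ∷ x) = cong₂ _∷_ (xor-same α) (⊕-self x)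

dot-comm : ∀ {n} (a x : V n) → dot a x ≡ dot x a
dot-comm []      []      = refl
dot-comm (α ∷ a) (ξ ∷ x) = cong₂ _xor_ (∧-comm α ξ) (dot-comm a x)

dot-0ˡ : ∀ {n} (x : V n) → dot 0V x ≡ false
dot-0ˡ []      = refl
dot-0ˡ (_ ∷ x) = dot-0ˡ x

dot-0ʳ : ∀ {n} (a : V n) → dot a 0V ≡ false
dot-0ʳ a = trans (dot-comm a 0V) (dot-0ˡ a)

dot-⊕ˡ : ∀ {n} (a b x : V n) → dot (a ⊕ b) x ≡ dot a x xor dot b x
dot-⊕ˡ []      []      []      = refl
dot-⊕ˡ (α ∷ a) (β ∷ b) (ξ ∷ x) = begin
  ((α xor β) ∧ ξ) xor dot (a ⊕ b) x
    ≡⟨ cong₂ _xor_ (∧-distribʳ-xor ξ α β) (dot-⊕ˡ a b x) ⟩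
  ((α ∧ ξ) xor (β ∧ ξ)) xor (dot a x xor dot b x)
    ≡⟨ interchange (α ∧ ξ) (β ∧ ξ) (dot a x) (dot b x) ⟩
  ((α ∧ ξ) xor dot a x) xor ((β ∧ ξ) xor dot b x)
    ∎

dot-⊕ʳ : ∀ {n} (a x y : V n) → dot a (x ⊕ y) ≡ dot a x xor dot a y
dot-⊕ʳ a x y = begin
  dot a (x ⊕ y)           ≡⟨ dot-comm a (x ⊕ y) ⟩
  dot (x ⊕ y) a           ≡⟨ dot-⊕ˡ x y a ⟩
  dot x a xor dot y a     ≡⟨ cong₂ _xor_ (dot-comm x a) (dot-comm y a) ⟩
  dot a x xor dot a y     ∎

dot-++ : ∀ {m k} (a x : V m) (b y : V k) →
  dot (a Vec.++ b) (x Vec.++ y) ≡ dot a x xor dot b y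
dot-++ []      []      b y = refl
dot-++ (α ∷ a) (ξ ∷ x) b y = trans (cong ((α ∧ ξ) xor_) (dot-++ a x b y))
                                   (sym (xor-assoc (α ∧ ξ) (dot a x) (dot b y)))

dot-separates : ∀ {n} {a b : V n} → (∀ t → dot t a ≡ dot t b) → a ≡ b
dot-separates {a = []}    {[]}    _ = refl
dot-separates {a = α ∷ a} {β ∷ b} h = cong₂ _∷_ α≡β (dot-separates (h ∘ (false ∷_)))
  where
  α≡β : α ≡ β
  α≡β = begin
    α                  ≡⟨ sym (xor-identityʳ α) ⟩
    α xor false        ≡⟨ cong (α xor_) (sym (dot-0ˡ a)) ⟩
    α xor dot 0V a     ≡⟨ h (true ∷ 0V) ⟩
    β xor dot 0V b     ≡⟨ cong (β xor_) (dot-0ˡ b) ⟩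
    β xor false        ≡⟨ xor-identityʳ β ⟩
    β                  ∎

0W : ∀ {n} → W n
0W = 0V , 0V

⊕W-assoc : ∀ {n} (u v w : W n) → (u ⊕W v) ⊕W w ≡ u ⊕W (v ⊕W w)
⊕W-assoc (x , a) (y , b) (z , c) = cong₂ _,_ (⊕-assoc x y z) (⊕-assoc a b c)

⊕W-identityˡ : ∀ {n} (u : W n) → 0W ⊕W u ≡ u
⊕W-identityˡ (x , a) = cong₂ _,_ (⊕-identityˡ x) (⊕-identityˡ a)

⊕W-identityʳ : ∀ {n} (u : W n) → u ⊕W 0W ≡ u
⊕W-identityʳ (x , a) = cong₂ _,_ (⊕-identityʳ x) (⊕-identityʳ a)

⊕W-self : ∀ {n} (u : W n) → u ⊕W u ≡ 0W
⊕W-self (x , a) = cong₂ _,_ (⊕-self x) (⊕-self a)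

⊕W-cancelʳ : ∀ {n} (u v : W n) → (u ⊕W v) ⊕W v ≡ u
⊕W-cancelʳ u v = begin
  (u ⊕W v) ⊕W v   ≡⟨ ⊕W-assoc u v v ⟩
  u ⊕W (v ⊕W v)   ≡⟨ cong (u ⊕W_) (⊕W-self v) ⟩
  u ⊕W 0W         ≡⟨ ⊕W-identityʳ u ⟩
  u               ∎

polar : ∀ {n} → W n → W n → Bool
polar (x , a) (y , b) = dot a y xor dot b x

polar-comm : ∀ {n} (u v : W n) → polar u v ≡ polar v u
polar-comm (x , a) (y , b) = xor-comm (dot a y) (dot b x)

polar-self : ∀ {n} (u : W n) → polar u u ≡ false
polar-self (x , a) = xor-same (dot a x)

polar-0ʳ : ∀ {n} (u : W n) → polar u 0W ≡ false
polar-0ʳ (x , a) = cong₂ _xor_ (dot-0ʳ a) (dot-0ˡ x)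

polar-0ˡ : ∀ {n} (u : W n) → polar 0W u ≡ false
polar-0ˡ u = trans (polar-comm 0W u) (polar-0ʳ u)

polar-⊕ʳ : ∀ {n} (w u v : W n) → polar w (u ⊕W v) ≡ polar w u xor polar w v
polar-⊕ʳ (z , c) (x , a) (y , b) = begin
  dot c (x ⊕ y) xor dot (a ⊕ b) z                    ≡⟨ cong₂ _xor_ (dot-⊕ʳ c x y) (dot-⊕ˡ a b z) ⟩
  (dot c x xor dot c y) xor (dot a z xor dot b z)    ≡⟨ interchange (dot c x) (dot c y) (dot a z) (dot b z) ⟩
  (dot c x xor dot a z) xor (dot c y xor dot b z)    ∎

polar-⊕ˡ : ∀ {n} (u v w : W n) → polar (u ⊕W v) w ≡ polar u w xor polar v w
polar-⊕ˡ u v w = begin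
  polar (u ⊕W v) w           ≡⟨ polar-comm (u ⊕W v) w ⟩
  polar w (u ⊕W v)           ≡⟨ polar-⊕ʳ w u v ⟩
  polar w u xor polar w v    ≡⟨ cong₂ _xor_ (polar-comm w u) (polar-comm w v) ⟩
  polar u w xor polar v w    ∎

polar-separates : ∀ {n} {u v : W n} → (∀ t → polar u t ≡ polar v t) → u ≡ v
polar-separates {u = x , a} {y , b} h = cong₂ _,_
  (dot-separates λ t → begin
    dot t x                ≡⟨ cong (_xor dot t x) (sym (dot-0ʳ a)) ⟩
    dot a 0V xor dot t x   ≡⟨ h (0V , t) ⟩
    dot b 0V xor dot t y   ≡⟨ cong (_xor dot t y) (dot-0ʳ b) ⟩
    dot t y                ∎)
  (dot-separates λ t → begin
    dot t a                ≡⟨ dot-comm t a ⟩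
    dot a t                ≡⟨ sym (xor-identityʳ (dot a t)) ⟩
    dot a t xor false      ≡⟨ cong (dot a t xor_) (sym (dot-0ˡ x)) ⟩
    dot a t xor dot 0V x   ≡⟨ h (t , 0V) ⟩
    dot b t xor dot 0V y   ≡⟨ cong (dot b t xor_) (dot-0ˡ y) ⟩
    dot b t xor false      ≡⟨ xor-identityʳ (dot b t) ⟩
    dot b t                ≡⟨ dot-comm b t ⟩
    dot t b                ∎)

Q-⊕W : ∀ {n} (u v : W n) → Q (u ⊕W v) ≡ (Q u xor Q v) xor polar u v
Q-⊕W (x , a) (y , b) = begin
  dot (a ⊕ b) (x ⊕ y)
    ≡⟨ dot-⊕ˡ a b (x ⊕ y) ⟩
  dot a (x ⊕ y) xor dot b (x ⊕ y)
    ≡⟨ cong₂ _xor_ (dot-⊕ʳ a x y) (dot-⊕ʳ b x y) ⟩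
  (dot a x xor dot a y) xor (dot b x xor dot b y)
    ≡⟨ cong ((dot a x xor dot a y) xor_) (xor-comm (dot b x) (dot b y)) ⟩
  (dot a x xor dot a y) xor (dot b y xor dot b x)
    ≡⟨ interchange (dot a x) (dot a y) (dot b y) (dot b x) ⟩
  (dot a x xor dot b y) xor (dot a y xor dot b x)
    ∎

polar-via-Q : ∀ {n} (u v : W n) → polar u v ≡ (Q u xor Q v) xor Q (u ⊕W v)
polar-via-Q u v = sym (trans (cong ((Q u xor Q v) xor_) (Q-⊕W u v)) (xor-cancelˡ (Q u xor Q v) (polar u v)))

Q-⊕W-nonsingular : ∀ {n} (u v : W n) → Q u ≡ false → Q v ≡ true → polar u v ≡ false → Q (u ⊕W v) ≡ true
Q-⊕W-nonsingular u v Qu Qv u⊥v rewrite Q-⊕W u v | Qu | Qv | u⊥v = refl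

_⊞_ : ∀ {m k} → W m → W k → W (m + k)
(x , a) ⊞ (y , b) = x Vec.++ y , a Vec.++ b

Q-⊞ : ∀ {m k} (u : W m) (v : W k) → Q (u ⊞ v) ≡ Q u xor Q v
Q-⊞ (x , a) (y , b) = dot-++ a x b y

polar-⊞ : ∀ {m k} (u u′ : W m) (v v′ : W k) →
  polar (u ⊞ v) (u′ ⊞ v′) ≡ polar u u′ xor polar v v′
polar-⊞ (x , a) (x′ , a′) (y , b) (y′ , b′) = begin
  dot (a Vec.++ b) (x′ Vec.++ y′) xor dot (a′ Vec.++ b′) (x Vec.++ y)
    ≡⟨ cong₂ _xor_ (dot-++ a x′ b y′) (dot-++ a′ x b′ y) ⟩
  (dot a x′ xor dot b y′) xor (dot a′ x xor dot b′ y)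
    ≡⟨ interchange (dot a x′) (dot b y′) (dot a′ x) (dot b′ y) ⟩
  (dot a x′ xor dot a′ x) xor (dot b y′ xor dot b′ y)
    ∎

Additive : ∀ {n} → (W n → W n) → Set
Additive h = ∀ u v → h (u ⊕W v) ≡ h u ⊕W h v

additive-id : ∀ {n} → Additive {n} (λ w → w)
additive-id _ _ = refl

additive-∘ : ∀ {n} {h k : W n → W n} → Additive h → Additive k → Additive (h ∘ k)
additive-∘ {h = h} {k} h-additive k-additive u v =
  trans (cong h (k-additive u v)) (h-additive (k u) (k v))

additive-0 : ∀ {n} {h : W n → W n} → Additive h → h 0W ≡ 0W
additive-0 {h = h} h-additive = begin
  h 0W              ≡⟨ cong h (sym (⊕W-self 0W)) ⟩
  h (0W ⊕W 0W)      ≡⟨ h-additive 0W 0W ⟩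
  h 0W ⊕W h 0W      ≡⟨ ⊕W-self (h 0W) ⟩
  0W                ∎

vec : ∀ {n} → AntiFlag n → W n
vec = proj₁

vec-injective : ∀ {n} {a b : AntiFlag n} → vec a ≡ vec b → a ≡ b
vec-injective {a = w , p} {.w , q} refl = cong (w ,_) (Decidable⇒UIP.≡-irrelevant _≟_ p q)

Adj₁⇔polar : ∀ {n} (a b : AntiFlag n) → Adj₁ a b ⇔ polar (vec a) (vec b) ≡ true
Adj₁⇔polar a b = mk⇔
  (λ (_ , incidence) → Equivalence.from (xor≡true⇔ _ _) incidence)
  (λ B≡true → a≢b B≡true , Equivalence.to (xor≡true⇔ _ _) B≡true)
  where
  a≢b : polar (vec a) (vec b) ≡ true → a ≢ b
  a≢b B≡true refl with trans (sym B≡true) (polar-self (vec a))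
  ... | ()

PolarPreserving : ∀ {n} → (AntiFlag n → AntiFlag n) → Set
PolarPreserving σ = ∀ a b → polar (vec (σ a)) (vec (σ b)) ≡ polar (vec a) (vec b)

automorphism-polarPreserving : ∀ {n} {σ : AntiFlag n → AntiFlag n} → IsAutΓ₁ σ → PolarPreserving σ
automorphism-polarPreserving {σ = σ} (_ , preserves) a b = ⇔→≡ (mk⇔
  (Equivalence.to (Adj₁⇔polar a b) ∘ proj₂ (preserves a b) ∘ Equivalence.from (Adj₁⇔polar (σ a) (σ b)))
  (Equivalence.to (Adj₁⇔polar (σ a) (σ b)) ∘ proj₁ (preserves a b) ∘ Equivalence.from (Adj₁⇔polar a b)))

polarPreserving⇒adjacency : ∀ {n} {σ : AntiFlag n → AntiFlag n} → PolarPreserving σ →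
  ∀ a b → (Adj₁ a b → Adj₁ (σ a) (σ b)) × (Adj₁ (σ a) (σ b) → Adj₁ a b)
polarPreserving⇒adjacency {σ = σ} σ-polar a b =
  Equivalence.from (Adj₁⇔polar (σ a) (σ b)) ∘ trans (σ-polar a b) ∘ Equivalence.to (Adj₁⇔polar a b) ,
  Equivalence.from (Adj₁⇔polar a b) ∘ trans (sym (σ-polar a b)) ∘ Equivalence.to (Adj₁⇔polar (σ a) (σ b))

polar-preserved : ∀ {n} (G : OPlus n) (u v : W n) → polar (g G u) (g G v) ≡ polar u v
polar-preserved G u v = begin
  polar (g G u) (g G v)
    ≡⟨ polar-via-Q (g G u) (g G v) ⟩
  (Q (g G u) xor Q (g G v)) xor Q (g G u ⊕W g G v)
    ≡⟨ cong ((Q (g G u) xor Q (g G v)) xor_) (cong Q (sym (linear G u v))) ⟩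
  (Q (g G u) xor Q (g G v)) xor Q (g G (u ⊕W v))
    ≡⟨ cong₂ _xor_ (cong₂ _xor_ (presQ G u) (presQ G v)) (presQ G (u ⊕W v)) ⟩
  (Q u xor Q v) xor Q (u ⊕W v)
    ≡⟨ sym (polar-via-Q u v) ⟩
  polar u v
    ∎

_⁻¹ : ∀ {n} → OPlus n → OPlus n
G ⁻¹ = record
  { g      = ginv G
  ; ginv   = g G
  ; linear = ginv-additive
  ; left   = right G
  ; right  = left G
  ; presQ  = λ w → trans (sym (presQ G (ginv G w))) (cong Q (right G w))
  }
  where
  ginv-additive : Additive (ginv G)
  ginv-additive u v = begin
    ginv G (u ⊕W v)                                 ≡⟨ cong (ginv G) (sym (cong₂ _⊕W_ (right G u) (right G v))) ⟩
    ginv G (g G (ginv G u) ⊕W g G (ginv G v))       ≡⟨ cong (ginv G) (sym (linear G (ginv G u) (ginv G v))) ⟩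
    ginv G (g G (ginv G u ⊕W ginv G v))             ≡⟨ left G (ginv G u ⊕W ginv G v) ⟩
    ginv G u ⊕W ginv G v                            ∎

orthogonal⇒automorphism : ∀ {n} (G : OPlus n) → IsAutΓ₁ (act G)
orthogonal⇒automorphism G =
  (act (G ⁻¹) , vec-injective ∘ left G ∘ vec , vec-injective ∘ right G ∘ vec) ,
  polarPreserving⇒adjacency (λ a b → polar-preserved G (vec a) (vec b))

⨁ : ∀ {n} → List (AntiFlag n) → W n
⨁ []      = 0W
⨁ (a ∷ L) = vec a ⊕W ⨁ L

⨁-++ : ∀ {n} (L M : List (AntiFlag n)) → ⨁ (L ++ M) ≡ ⨁ L ⊕W ⨁ M
⨁-++ []      M = sym (⊕W-identityˡ (⨁ M))
⨁-++ (a ∷ L) M = trans (cong (vec a ⊕W_) (⨁-++ L M)) (sym (⊕W-assoc (vec a) (⨁ L) (⨁ M)))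

AntiFlagsSpan : ℕ → Set
AntiFlagsSpan n = (w : W n) → Σ (List (AntiFlag n)) (λ L → ⨁ L ≡ w)

e₁+f₁ e₂+f₂ e₁+e₂+f₁ e₁+f₁+f₂ : W 2
e₁+f₁    = true  ∷ false ∷ [] , true  ∷ false ∷ []
e₂+f₂    = false ∷ true  ∷ [] , false ∷ true  ∷ []
e₁+e₂+f₁ = true  ∷ true  ∷ [] , true  ∷ false ∷ []
e₁+f₁+f₂ = true  ∷ false ∷ [] , true  ∷ true  ∷ []

-- polar w has a kernel of dimension ≥ 3 in the 4-dimensional hyperbolic space W 2, and such
-- a subspace contains a non-singular vector since the Witt index of W 2 is 2.
hyperbolic-witness : (w : W 2) → Σ (W 2) (λ c → Q c ≡ true × polar w c ≡ false)
hyperbolic-witness (false ∷ false ∷ [] , false ∷ false ∷ []) = e₁+f₁ , refl , refl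
hyperbolic-witness (false ∷ false ∷ [] , false ∷ true  ∷ []) = e₁+f₁ , refl , refl
hyperbolic-witness (false ∷ false ∷ [] , true  ∷ false ∷ []) = e₂+f₂ , refl , refl
hyperbolic-witness (false ∷ false ∷ [] , true  ∷ true  ∷ []) = e₁+e₂+f₁ , refl , refl
hyperbolic-witness (false ∷ true  ∷ [] , false ∷ false ∷ []) = e₁+f₁ , refl , refl
hyperbolic-witness (false ∷ true  ∷ [] , false ∷ true  ∷ []) = e₁+f₁ , refl , refl
hyperbolic-witness (false ∷ true  ∷ [] , true  ∷ false ∷ []) = e₁+f₁+f₂ , refl , refl
hyperbolic-witness (false ∷ true  ∷ [] , true  ∷ true  ∷ []) = e₂+f₂ , refl , refl
hyperbolic-witness (true  ∷ false ∷ [] , false ∷ false ∷ []) = e₂+f₂ , refl , refl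
hyperbolic-witness (true  ∷ false ∷ [] , false ∷ true  ∷ []) = e₁+e₂+f₁ , refl , refl
hyperbolic-witness (true  ∷ false ∷ [] , true  ∷ false ∷ []) = e₁+f₁ , refl , refl
hyperbolic-witness (true  ∷ false ∷ [] , true  ∷ true  ∷ []) = e₁+f₁ , refl , refl
hyperbolic-witness (true  ∷ true  ∷ [] , false ∷ false ∷ []) = e₁+f₁+f₂ , refl , refl
hyperbolic-witness (true  ∷ true  ∷ [] , false ∷ true  ∷ []) = e₂+f₂ , refl , refl
hyperbolic-witness (true  ∷ true  ∷ [] , true  ∷ false ∷ []) = e₁+f₁ , refl , refl
hyperbolic-witness (true  ∷ true  ∷ [] , true  ∷ true  ∷ []) = e₁+f₁ , refl , refl

nonsingular-orthogonal : ∀ {n} → 2 ≤ n → (w : W n) → Σ (AntiFlag n) (λ c → polar w (vec c) ≡ false)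
nonsingular-orthogonal {suc (suc k)} (s≤s (s≤s _)) (x₁ ∷ x₂ ∷ x , a₁ ∷ a₂ ∷ a)
  with hyperbolic-witness (x₁ ∷ x₂ ∷ [] , a₁ ∷ a₂ ∷ [])
... | c , Qc , w₂⊥c =
  (c ⊞ 0W {k} , trans (Q-⊞ c 0W) (cong₂ _xor_ Qc (dot-0ˡ (0V {k})))) ,
  trans (polar-⊞ (x₁ ∷ x₂ ∷ [] , a₁ ∷ a₂ ∷ []) c (x , a) 0W) (cong₂ _xor_ w₂⊥c (polar-0ʳ (x , a)))

antiFlagsSpan : ∀ {n} → 2 ≤ n → AntiFlagsSpan n
antiFlagsSpan 2≤n w with Q w in Qw
... | true  = (w , Qw) ∷ [] , ⊕W-identityʳ w
... | false with nonsingular-orthogonal 2≤n w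
...   | c , w⊥c = (w ⊕W vec c , Q-⊕W-nonsingular w (vec c) Qw (proj₂ c) w⊥c) ∷ c ∷ [] ,
                  trans (cong ((w ⊕W vec c) ⊕W_) (⊕W-identityʳ (vec c))) (⊕W-cancelʳ w (vec c))

polar-determined : ∀ {n} → AntiFlagsSpan n → {u v : W n} →
  (∀ a → polar u (vec a) ≡ polar v (vec a)) → u ≡ v
polar-determined span {u} {v} agree = polar-separates λ t →
  subst (λ t → polar u t ≡ polar v t) (proj₂ (span t)) (agree-⨁ (proj₁ (span t)))
  where
  agree-⨁ : ∀ L → polar u (⨁ L) ≡ polar v (⨁ L)
  agree-⨁ []      = trans (polar-0ʳ u) (sym (polar-0ʳ v))
  agree-⨁ (a ∷ L) = begin
    polar u (vec a ⊕W ⨁ L)           ≡⟨ polar-⊕ʳ u (vec a) (⨁ L) ⟩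
    polar u (vec a) xor polar u (⨁ L) ≡⟨ cong₂ _xor_ (agree a) (agree-⨁ L) ⟩
    polar v (vec a) xor polar v (⨁ L) ≡⟨ sym (polar-⊕ʳ v (vec a) (⨁ L)) ⟩
    polar v (vec a ⊕W ⨁ L)           ∎

additive-unique : ∀ {n} → AntiFlagsSpan n → {h k : W n → W n} → Additive h → Additive k →
  (∀ a → h (vec a) ≡ k (vec a)) → ∀ w → h w ≡ k w
additive-unique span {h} {k} h-additive k-additive agree w =
  subst (λ w → h w ≡ k w) (proj₂ (span w)) (agree-⨁ (proj₁ (span w)))
  where
  agree-⨁ : ∀ L → h (⨁ L) ≡ k (⨁ L)
  agree-⨁ []      = trans (additive-0 h-additive) (sym (additive-0 k-additive))
  agree-⨁ (a ∷ L) = begin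
    h (vec a ⊕W ⨁ L)        ≡⟨ h-additive (vec a) (⨁ L) ⟩
    h (vec a) ⊕W h (⨁ L)    ≡⟨ cong₂ _⊕W_ (agree a) (agree-⨁ L) ⟩
    k (vec a) ⊕W k (⨁ L)    ≡⟨ sym (k-additive (vec a) (⨁ L)) ⟩
    k (vec a ⊕W ⨁ L)        ∎

additive-inverse : ∀ {n} → AntiFlagsSpan n → {h k : W n → W n} {φ ψ : AntiFlag n → AntiFlag n} →
  Additive h → Additive k → (∀ a → h (vec a) ≡ vec (φ a)) → (∀ a → k (vec a) ≡ vec (ψ a)) →
  (∀ a → ψ (φ a) ≡ a) → ∀ w → k (h w) ≡ w
additive-inverse span {h} {k} {φ} {ψ} h-additive k-additive h-vec k-vec ψ∘φ =
  additive-unique span (additive-∘ k-additive h-additive) additive-id λ a → begin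
    k (h (vec a))     ≡⟨ cong k (h-vec a) ⟩
    k (vec (φ a))     ≡⟨ k-vec (φ a) ⟩
    vec (ψ (φ a))     ≡⟨ cong vec (ψ∘φ a) ⟩
    vec a             ∎

module _ {n} (σ : AntiFlag n → AntiFlag n) (σ-polar : PolarPreserving σ) where

  polar-image : ∀ L a → polar (⨁ (map σ L)) (vec (σ a)) ≡ polar (⨁ L) (vec a)
  polar-image []      a = trans (polar-0ˡ (vec (σ a))) (sym (polar-0ˡ (vec a)))
  polar-image (b ∷ L) a = begin
    polar (vec (σ b) ⊕W ⨁ (map σ L)) (vec (σ a))
      ≡⟨ polar-⊕ˡ (vec (σ b)) (⨁ (map σ L)) (vec (σ a)) ⟩
    polar (vec (σ b)) (vec (σ a)) xor polar (⨁ (map σ L)) (vec (σ a))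
      ≡⟨ cong₂ _xor_ (σ-polar b a) (polar-image L a) ⟩
    polar (vec b) (vec a) xor polar (⨁ L) (vec a)
      ≡⟨ sym (polar-⊕ˡ (vec b) (⨁ L) (vec a)) ⟩
    polar (vec b ⊕W ⨁ L) (vec a)
      ∎

  Q-image : ∀ L → Q (⨁ (map σ L)) ≡ Q (⨁ L)
  Q-image []      = refl
  Q-image (a ∷ L) = begin
    Q (vec (σ a) ⊕W ⨁ (map σ L))
      ≡⟨ Q-⊕W (vec (σ a)) (⨁ (map σ L)) ⟩
    (Q (vec (σ a)) xor Q (⨁ (map σ L))) xor polar (vec (σ a)) (⨁ (map σ L))
      ≡⟨ cong₂ _xor_ (cong₂ _xor_ (trans (proj₂ (σ a)) (sym (proj₂ a))) (Q-image L)) polar-image′ ⟩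
    (Q (vec a) xor Q (⨁ L)) xor polar (vec a) (⨁ L)
      ≡⟨ sym (Q-⊕W (vec a) (⨁ L)) ⟩
    Q (vec a ⊕W ⨁ L)
      ∎
    where
    polar-image′ : polar (vec (σ a)) (⨁ (map σ L)) ≡ polar (vec a) (⨁ L)
    polar-image′ = trans (polar-comm (vec (σ a)) (⨁ (map σ L)))
                         (trans (polar-image L a) (polar-comm (⨁ L) (vec a)))

-- σ∘τ makes the image of σ span W, which is what makes extend well defined.
module Extension {n} (span : AntiFlagsSpan n) (σ τ : AntiFlag n → AntiFlag n)
                 (σ∘τ : ∀ a → σ (τ a) ≡ a) (σ-polar : PolarPreserving σ) where

  image-respects-⨁ : ∀ L M → ⨁ L ≡ ⨁ M → ⨁ (map σ L) ≡ ⨁ (map σ M)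
  image-respects-⨁ L M ⨁L≡⨁M = polar-determined span λ a → begin
    polar (⨁ (map σ L)) (vec a)            ≡⟨ cong (polar (⨁ (map σ L)) ∘ vec) (sym (σ∘τ a)) ⟩
    polar (⨁ (map σ L)) (vec (σ (τ a)))    ≡⟨ polar-image σ σ-polar L (τ a) ⟩
    polar (⨁ L) (vec (τ a))                ≡⟨ cong (λ u → polar u (vec (τ a))) ⨁L≡⨁M ⟩
    polar (⨁ M) (vec (τ a))                ≡⟨ sym (polar-image σ σ-polar M (τ a)) ⟩
    polar (⨁ (map σ M)) (vec (σ (τ a)))    ≡⟨ cong (polar (⨁ (map σ M)) ∘ vec) (σ∘τ a) ⟩
    polar (⨁ (map σ M)) (vec a)            ∎

  extend : W n → W n
  extend w = ⨁ (map σ (proj₁ (span w)))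

  extend-⨁ : ∀ L → extend (⨁ L) ≡ ⨁ (map σ L)
  extend-⨁ L = image-respects-⨁ (proj₁ (span (⨁ L))) L (proj₂ (span (⨁ L)))

  extend-vec : ∀ a → extend (vec a) ≡ vec (σ a)
  extend-vec a = begin
    extend (vec a)          ≡⟨ cong extend (sym (⊕W-identityʳ (vec a))) ⟩
    extend (⨁ (a ∷ []))     ≡⟨ extend-⨁ (a ∷ []) ⟩
    vec (σ a) ⊕W 0W         ≡⟨ ⊕W-identityʳ (vec (σ a)) ⟩
    vec (σ a)               ∎

  extend-additive : Additive extend
  extend-additive u v = begin
    extend (u ⊕W v)                          ≡⟨ cong extend (sym ⨁-split) ⟩
    extend (⨁ (Lu ++ Lv))                    ≡⟨ extend-⨁ (Lu ++ Lv) ⟩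
    ⨁ (map σ (Lu ++ Lv))                     ≡⟨ cong ⨁ (map-++ σ Lu Lv) ⟩
    ⨁ (map σ Lu ++ map σ Lv)                 ≡⟨ ⨁-++ (map σ Lu) (map σ Lv) ⟩
    extend u ⊕W extend v                     ∎
    where
    Lu = proj₁ (span u)
    Lv = proj₁ (span v)
    ⨁-split : ⨁ (Lu ++ Lv) ≡ u ⊕W v
    ⨁-split = trans (⨁-++ Lu Lv) (cong₂ _⊕W_ (proj₂ (span u)) (proj₂ (span v)))

  extend-Q : ∀ w → Q (extend w) ≡ Q w
  extend-Q w = trans (Q-image σ σ-polar (proj₁ (span w))) (cong Q (proj₂ (span w)))

automorphism⇒orthogonal : ∀ {n} → AntiFlagsSpan n → (σ : AntiFlag n → AntiFlag n) → IsAutΓ₁ σ →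
  Σ (OPlus n) (λ G → ∀ a → act G a ≡ σ a)
automorphism⇒orthogonal span σ aut@((τ , τ∘σ , σ∘τ) , _) = G , vec-injective ∘ Eσ.extend-vec
  where
  σ-polar : PolarPreserving σ
  σ-polar = automorphism-polarPreserving aut
  τ-polar : PolarPreserving τ
  τ-polar a b = begin
    polar (vec (τ a)) (vec (τ b))
      ≡⟨ sym (σ-polar (τ a) (τ b)) ⟩
    polar (vec (σ (τ a))) (vec (σ (τ b)))
      ≡⟨ cong₂ (λ c d → polar (vec c) (vec d)) (σ∘τ a) (σ∘τ b) ⟩
    polar (vec a) (vec b)
      ∎
  module Eσ = Extension span σ τ σ∘τ σ-polar
  module Eτ = Extension span τ σ τ∘σ τ-polar
  G : OPlus _
  G = record
    { g      = Eσ.extend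
    ; ginv   = Eτ.extend
    ; linear = Eσ.extend-additive
    ; left   = additive-inverse span {φ = σ} {τ}
                 Eσ.extend-additive Eτ.extend-additive Eσ.extend-vec Eτ.extend-vec τ∘σ
    ; right  = additive-inverse span {φ = τ} {σ}
                 Eτ.extend-additive Eσ.extend-additive Eτ.extend-vec Eσ.extend-vec σ∘τ
    ; presQ  = Eσ.extend-Q
    }

act-faithful : ∀ {n} → AntiFlagsSpan n → (G H : OPlus n) → (∀ a → act G a ≡ act H a) →
  ∀ w → g G w ≡ g H w
act-faithful span G H same-action = additive-unique span (linear G) (linear H) (cong vec ∘ same-action)

corollary3 : (n : ℕ) → 3 ≤ n →
    ((G : OPlus n) → IsAutΓ₁ (act G)) ×
    ((σ : AntiFlag n → AntiFlag n) → IsAutΓ₁ σ →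
       Σ (OPlus n) (λ G → (a : AntiFlag n) → act G a ≡ σ a)) ×
    ((G H : OPlus n) → ((a : AntiFlag n) → act G a ≡ act H a) →
       (w : W n) → g G w ≡ g H w)
corollary3 n 3≤n = orthogonal⇒automorphism , automorphism⇒orthogonal span , act-faithful span
  where
  span : AntiFlagsSpan n
  span = antiFlagsSpan (<⇒≤ 3≤n)
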